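{- Let $G$ be a strong digraph whose underlying graph $G^-$ is 2-connected, and let $u,v\in V(G)$ be such that $G^-\setminus\{u,v\}$ is disconnected, with components $D_1,\dots,D_k$. Then for each $i\in\{1,\dots,k\}$ there is a directed path $P_i$ of $G[V(D_i)\cup\{u,v\}]$, either from $u$ to $v$ or from $v$ to $u$, of length at least two.
   Context: Digraphs are finite, with no loops, no parallel edges and no directed cycles of length two. A digraph is strong if it is strongly connected. $G^-$ denotes the underlying undirected graph of $G$, and $G[X]$ the subdigraph induced on $X$. -}

module Defs where

open import Data.Nat using (ℕ; _≤_; _∸_)
open import Data.Fin using (Fin)
open import Data.Bool using (Bool; true)
open import Data.List using (List; []; _∷_; length)
open import Data.List.Relation.Unary.All using (All)
open import Data.List.Relation.Unary.Unique.Propositional using (Unique)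
open import Data.Product using (_×_; Σ; ∃-syntax)
open import Data.Sum using (_⊎_)
open import Relation.Nullary using (¬_)
open import Relation.Binary.PropositionalEquality using (_≡_; _≢_)
open import Relation.Binary.Construct.Closure.ReflexiveTransitive using (Star)

-- Being a relation, it
-- has no parallel edges; we require no loops and no 2-cycles.
record Digraph (n : ℕ) : Set where
  field
    adj       : Fin n → Fin n → Bool
    loopless  : ∀ x → adj x x ≢ true
    no2cycles : ∀ x y → adj x y ≡ true → adj y x ≢ true

module _ {n : ℕ} (G : Digraph n) where
  open Digraph G

  Arc : Fin n → Fin n → Set
  Arc x y = adj x y ≡ true

  UEdge : Fin n → Fin n → Set
  UEdge x y = Arc x y ⊎ Arc y x

  Strong : Set
  Strong = ∀ x y → Star Arc x y

  ConnIn : (Fin n → Set) → Fin n → Fin n → Set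
  ConnIn S = Star (λ a b → S a × S b × UEdge a b)

  ConnectedIn : (Fin n → Set) → Set
  ConnectedIn S = ∀ x y → S x → S y → ConnIn S x y


  Avoid1 : Fin n → Fin n → Set
  Avoid1 z x = x ≢ z

  Avoid2 : Fin n → Fin n → Fin n → Set
  Avoid2 u v x = (x ≢ u) × (x ≢ v)

  TwoConnected : Set
  TwoConnected = (3 ≤ n)
               × (∀ (x y : Fin n) → Star UEdge x y)
               × (∀ z → ConnectedIn (Avoid1 z))

  data DWalk : Fin n → Fin n → List (Fin n) → Set where
    here : ∀ {x} → DWalk x x (x ∷ [])
    step : ∀ {x y z vs} → Arc x y → DWalk y z vs → DWalk x z (x ∷ vs)

  DPath : Fin n → Fin n → List (Fin n) → Set
  DPath x y vs = DWalk x y vs × Unique vs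

  pathLength : List (Fin n) → ℕ
  pathLength vs = length vs ∸ 1

{-# OPTIONS --safe #-}
module Submission where

-- Let D be the component of w in G⁻ ∖ {u,v}.  Since G is strong, every d ∈ D
-- is entered by an arc from u or v and left by an arc to u or v, with the
-- walk in between inside D.  If w is entered from one of u, v and left to the
-- other, this walk is the required path (after shortcutting).  Otherwise w
-- returns to a single a ∈ {u,v}, say.  Moving along an edge of D either
-- produces the required path or preserves "returns to a", and since a is not
-- a cut vertex some d ∈ D that returns to a is adjacent to the other vertex b;
-- the edge between d and b then completes an a–b or b–a path through D.

open import Defs
open import Data.Nat using (ℕ; _≤_; z≤n; s≤s)
open import Data.Fin using (Fin; _≟_)
open import Data.List using ([]; _∷_; length)
open import Data.List.Relation.Unary.All as All using (All; []; _∷_)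
open import Data.List.Relation.Unary.All.Properties using (¬Any⇒All¬)
open import Data.List.Relation.Unary.Any using (here; there)
open import Data.List.Relation.Unary.AllPairs using ([]; _∷_)
open import Data.List.Membership.Propositional using (_∈_)
open import Data.Product using (_×_; ∃-syntax; _,_; proj₁; proj₂)
open import Data.Sum as Sum using (_⊎_; inj₁; inj₂)
open import Data.Empty using (⊥-elim)
open import Function using (_∘_; id; flip)
open import Relation.Nullary using (¬_; yes; no)
open import Relation.Nullary.Decidable using (¬?; _×-dec_)
open import Relation.Unary using (Decidable; _⊆_)
open import Relation.Binary.PropositionalEquality using (_≡_; _≢_; refl; sym)
open import Relation.Binary.Construct.Closure.ReflexiveTransitive
  using (Star; ε; _◅_; _◅◅_; map; reverse; return)

Within : ∀ {n} → (Fin n → Set) → (Fin n → Fin n → Set) → Fin n → Fin n → Set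
Within P R x y = P x × P y × R x y

module _ {n : ℕ} (G : Digraph n) where
  open import Data.List.Membership.DecPropositional (_≟_ {n = n}) using (_∈?_)

  suffix-path : ∀ {P : Fin n → Set} {x y z vs} → DPath G y z vs → All P vs → x ∈ vs →
                ∃[ ws ] (DPath G x z ws × All P ws)
  suffix-path (here , unique) ps (here refl) = _ , (here , unique) , ps
  suffix-path (step r walk , unique) ps (here refl) = _ , (step r walk , unique) , ps
  suffix-path (step _ walk , _ ∷ unique) (_ ∷ ps) (there x∈vs) = suffix-path (walk , unique) ps x∈vs

  walk⇒path : ∀ {P : Fin n → Set} {x y} → Star (Within P (Arc G)) x y → P x →
              ∃[ vs ] (DPath G x y vs × All P vs)
  walk⇒path {x = x} ε x∈P = x ∷ [] , (here , [] ∷ []) , x∈P ∷ []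
  walk⇒path {x = x} ((x∈P , x'∈P , x→x') ◅ walk) _ with walk⇒path walk x'∈P
  ... | vs , (path , unique) , ps with x ∈? vs
  ...   | yes x∈vs = suffix-path (path , unique) ps x∈vs
  ...   | no  x∉vs = x ∷ vs , (step x→x' path , ¬Any⇒All¬ vs x∉vs ∷ unique) , x∈P ∷ ps

  2≤length : ∀ {x y vs} → DWalk G x y vs → x ≢ y → 2 ≤ length vs
  2≤length here x≢y = ⊥-elim (x≢y refl)
  2≤length (step _ here) _ = s≤s (s≤s z≤n)
  2≤length (step _ (step _ _)) _ = s≤s (s≤s z≤n)

  connIn-mono : ∀ {P Q : Fin n → Set} → P ⊆ Q → ∀ {x y} → ConnIn G P x y → ConnIn G Q x y
  connIn-mono P⊆Q = map (λ (p , q , e) → P⊆Q p , P⊆Q q , e)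

module Component {n : ℕ} (G : Digraph n) {S : Fin n → Set} (S? : Decidable S)
                 {w : Fin n} (w∈S : S w) where

  D : Fin n → Set
  D x = ConnIn G S w x × S x

  w∈D : D w
  w∈D = ε , w∈S

  D-closed : ∀ {x y} → D x → S y → UEdge G x y → D y
  D-closed (w~x , x∈S) y∈S e = w~x ◅◅ return (x∈S , y∈S , e) , y∈S

  first-exit : ∀ {R : Fin n → Fin n → Set} → (∀ {x y} → R x y → UEdge G x y) →
               ∀ {x t} → D x → Star R x t → ¬ S t →
               ∃[ y ] ∃[ z ] (Star (Within D R) x y × D y × R y z × ¬ S z)
  first-exit toU x∈D ε t∉S = ⊥-elim (t∉S (proj₂ x∈D))
  first-exit toU {x} x∈D (_◅_ {j = x'} r rest) t∉S with S? x'
  ... | no x'∉S = x , x' , ε , x∈D , r , x'∉S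
  ... | yes x'∈S =
    let x'∈D = D-closed x∈D x'∈S (toU r)
        y , z , walk , y∈D , r' , z∉S = first-exit toU x'∈D rest t∉S
    in  y , z , (x∈D , x'∈D , r) ◅ walk , y∈D , r' , z∉S

  _⇝_ : Fin n → Fin n → Set
  _⇝_ = Star (Within D (Arc G))

  Enters : Fin n → Fin n → Set
  Enters a d = ∃[ d₀ ] (Arc G a d₀ × D d₀ × d₀ ⇝ d)

  Leaves : Fin n → Fin n → Set
  Leaves d b = ∃[ d₁ ] (d ⇝ d₁ × D d₁ × Arc G d₁ b)

  Through : Fin n → Fin n → Set
  Through a b = ∃[ d ] (Enters a d × Leaves d b)

  Returns : Fin n → Fin n → Set
  Returns a d = Enters a d × Leaves d a

  Linked : Fin n → Fin n → Set
  Linked a b = Through a b ⊎ Through b a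

  enters-◅ : ∀ {a d d'} → Enters a d → Within D (Arc G) d d' → Enters a d'
  enters-◅ (d₀ , a→d₀ , d₀∈D , walk) arc = d₀ , a→d₀ , d₀∈D , walk ◅◅ return arc

  leaves-◅ : ∀ {b d d'} → Within D (Arc G) d' d → Leaves d b → Leaves d' b
  leaves-◅ arc (d₁ , walk , d₁∈D , d₁→b) = d₁ , arc ◅ walk , d₁∈D , d₁→b

  leaves : Strong G → ∀ {d t} → D d → ¬ S t → ∃[ z ] (¬ S z × Leaves d z)
  leaves strong {d} {t} d∈D t∉S =
    let d₁ , z , walk , d₁∈D , d₁→z , z∉S = first-exit inj₁ d∈D (strong d t) t∉S
    in  z , z∉S , d₁ , walk , d₁∈D , d₁→z

  enters : Strong G → ∀ {d t} → D d → ¬ S t → ∃[ z ] (¬ S z × Enters z d)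
  -- The last entry into D along t ⇝ d is the first exit along the reversed walk.
  enters strong {d} {t} d∈D t∉S =
    let d₀ , z , walk , d₀∈D , z→d₀ , z∉S =
          first-exit inj₂ d∈D (reverse {U = flip (Arc G)} id (strong t d)) t∉S
    in  z , z∉S , d₀ , z→d₀ , d₀∈D , reverse (λ (p , q , r) → q , p , r) walk

  through⇒path : ∀ {a b} → a ≢ b → ¬ S a → ¬ S b → Through a b →
                 ∃[ vs ] (DPath G a b vs × 2 ≤ pathLength G vs
                          × All (λ x → (x ≡ a ⊎ x ≡ b) ⊎ D x) vs)
  through⇒path {a} {b} a≢b a∉S b∉S (_ , (d₀ , a→d₀ , d₀∈D , walk₀) , (d₁ , walk₁ , d₁∈D , d₁→b))
    with walk⇒path G inner (inj₁ d₀∈D)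
    where
      inner : Star (Within (λ x → D x ⊎ x ≡ b) (Arc G)) d₀ b
      inner = map (λ (p , q , r) → inj₁ p , inj₁ q , r) (walk₀ ◅◅ walk₁)
              ◅◅ return (inj₁ d₁∈D , inj₂ refl , d₁→b)
  ... | vs , (path , unique) , ps =
    a ∷ vs , (step a→d₀ path , All.map fresh ps ∷ unique) , 2≤length G path d₀≢b ,
    inj₁ (inj₁ refl) ∷ All.map (Sum.[ inj₂ , inj₁ ∘ inj₂ ]) ps
    where
      fresh : ∀ {x} → D x ⊎ x ≡ b → a ≢ x
      fresh (inj₁ x∈D) refl = a∉S (proj₂ x∈D)
      fresh (inj₂ refl) = a≢b
      d₀≢b : d₀ ≢ b
      d₀≢b refl = b∉S (proj₂ d₀∈D)

  module Boundary (strong : Strong G) {a b : Fin n} (a∉S : ¬ S a) (b∉S : ¬ S b)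
                  (boundary : ∀ {z} → ¬ S z → z ≡ a ⊎ z ≡ b) where

    at-boundary : ∀ {P : Fin n → Set} → ∃[ z ] (¬ S z × P z) → P a ⊎ P b
    at-boundary (z , z∉S , pz) with boundary z∉S
    ... | inj₁ refl = inj₁ pz
    ... | inj₂ refl = inj₂ pz

    enters-from : ∀ {d} → D d → Enters a d ⊎ Enters b d
    enters-from d∈D = at-boundary (enters strong d∈D a∉S)

    leaves-to : ∀ {d} → D d → Leaves d a ⊎ Leaves d b
    leaves-to d∈D = at-boundary (leaves strong d∈D a∉S)

    returns-step : ∀ {d d'} → Returns a d → Within D (UEdge G) d d' → Linked a b ⊎ Returns a d'
    returns-step (enter , _) (d∈D , d'∈D , inj₁ d→d') with leaves-to d'∈D
    ... | inj₁ leave' = inj₂ (enters-◅ enter (d∈D , d'∈D , d→d') , leave')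
    ... | inj₂ leave' = inj₁ (inj₁ (_ , enters-◅ enter (d∈D , d'∈D , d→d') , leave'))
    returns-step (_ , leave) (d∈D , d'∈D , inj₂ d'→d) with enters-from d'∈D
    ... | inj₁ enter' = inj₂ (enter' , leaves-◅ (d'∈D , d∈D , d'→d) leave)
    ... | inj₂ enter' = inj₁ (inj₂ (_ , enter' , leaves-◅ (d'∈D , d∈D , d'→d) leave))

    returns-along : ∀ {d d'} → Star (Within D (UEdge G)) d d' → Returns a d → Linked a b ⊎ Returns a d'
    returns-along ε ret = inj₂ ret
    returns-along (e ◅ walk) ret with returns-step ret e
    ... | inj₁ linked = inj₁ linked
    ... | inj₂ ret' = returns-along walk ret'

    returns-adjacent⇒linked : ∀ {d} → Returns a d → D d → UEdge G d b → Linked a b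
    returns-adjacent⇒linked (enter , _) d∈D (inj₁ d→b) = inj₁ (_ , enter , (_ , ε , d∈D , d→b))
    returns-adjacent⇒linked (_ , leave) d∈D (inj₂ b→d) = inj₂ (_ , (_ , b→d , d∈D , ε) , leave)

    returns⇒linked : ConnIn G (Avoid1 G a) w b → Returns a w → Linked a b
    returns⇒linked w~b ret with first-exit (proj₂ ∘ proj₂) w∈D w~b b∉S
    ... | y , z , walk , y∈D , (_ , z≢a , y~z) , z∉S
        with boundary z∉S | returns-along (map (λ (p , q , (_ , _ , e)) → p , q , e) walk) ret
    ...   | inj₁ z≡a  | _            = ⊥-elim (z≢a z≡a)
    ...   | inj₂ refl | inj₁ linked  = linked
    ...   | inj₂ refl | inj₂ ret'    = returns-adjacent⇒linked ret' y∈D y~z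

  linked : Strong G → ∀ {a b} → ¬ S a → ¬ S b → (∀ {z} → ¬ S z → z ≡ a ⊎ z ≡ b) →
           ConnIn G (Avoid1 G a) w b → ConnIn G (Avoid1 G b) w a → Linked a b
  linked strong {a} {b} a∉S b∉S boundary w~b w~a = by-cases (A.enters-from w∈D) (A.leaves-to w∈D)
    where
      module A = Boundary strong a∉S b∉S boundary
      module B = Boundary strong b∉S a∉S (Sum.swap ∘ boundary)
      by-cases : Enters a w ⊎ Enters b w → Leaves w a ⊎ Leaves w b → Linked a b
      by-cases (inj₁ ea) (inj₁ la) = A.returns⇒linked w~b (ea , la)
      by-cases (inj₁ ea) (inj₂ lb) = inj₁ (w , ea , lb)
      by-cases (inj₂ eb) (inj₁ la) = inj₂ (w , eb , la)
      by-cases (inj₂ eb) (inj₂ lb) = Sum.swap (B.returns⇒linked w~a (eb , lb))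

module _ {n : ℕ} (G : Digraph n) (u v : Fin n) where

  avoid2? : Decidable (Avoid2 G u v)
  avoid2? x = ¬? (x ≟ u) ×-dec ¬? (x ≟ v)

  ¬avoid2 : ∀ {z} → ¬ Avoid2 G u v z → z ≡ u ⊎ z ≡ v
  ¬avoid2 {z} z∉S with z ≟ u | z ≟ v
  ... | yes z≡u | _       = inj₁ z≡u
  ... | no _    | yes z≡v = inj₂ z≡v
  ... | no z≢u  | no z≢v  = ⊥-elim (z∉S (z≢u , z≢v))

  separating⇒distinct : TwoConnected G →
    (∃[ x ] ∃[ y ] (Avoid2 G u v x × Avoid2 G u v y × ¬ ConnIn G (Avoid2 G u v) x y)) → u ≢ v
  separating⇒distinct (_ , _ , noCut) (x , y , x∈S , y∈S , x≁y) refl =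
    x≁y (connIn-mono G (λ z≢u → z≢u , z≢u) (noCut u x y (proj₁ x∈S) (proj₁ y∈S)))

mainTheorem6 : ∀ {n : ℕ} (G : Digraph n) → Strong G → TwoConnected G →
    (u v : Fin n) →
    (∃[ x ] ∃[ y ] (Avoid2 G u v x × Avoid2 G u v y × ¬ ConnIn G (Avoid2 G u v) x y)) →
    ∀ (w : Fin n) → Avoid2 G u v w →
    ∃[ vs ] ((DPath G u v vs ⊎ DPath G v u vs)
             × 2 ≤ pathLength G vs
             × All (λ x → (x ≡ u ⊎ x ≡ v) ⊎ ConnIn G (Avoid2 G u v) w x) vs)
mainTheorem6 G strong tc@(_ , _ , noCut) u v separating w w∈S =
  orient (linked strong u∉S v∉S (¬avoid2 G u v)
                 (noCut u w v (proj₁ w∈S) (u≢v ∘ sym)) (noCut v w u (proj₂ w∈S) u≢v))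
  where
    open Component G (avoid2? G u v) w∈S
    u≢v : u ≢ v
    u≢v = separating⇒distinct G u v tc separating
    u∉S : ¬ Avoid2 G u v u
    u∉S (u≢u , _) = u≢u refl
    v∉S : ¬ Avoid2 G u v v
    v∉S (_ , v≢v) = v≢v refl
    orient : Linked u v →
             ∃[ vs ] ((DPath G u v vs ⊎ DPath G v u vs) × 2 ≤ pathLength G vs
                      × All (λ x → (x ≡ u ⊎ x ≡ v) ⊎ ConnIn G (Avoid2 G u v) w x) vs)
    orient (inj₁ u⇝v) =
      let vs , path , long , ps = through⇒path u≢v u∉S v∉S u⇝v
      in  vs , inj₁ path , long , All.map (Sum.map₂ proj₁) ps
    orient (inj₂ v⇝u) =
      let vs , path , long , ps = through⇒path (u≢v ∘ sym) v∉S u∉S v⇝u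
      in  vs , inj₂ path , long , All.map (Sum.map Sum.swap proj₁) ps
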